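{- Let $T$ be a tree of order $n\geq 2$. Then \[\gamma_{LD}(T)\leq\frac{n+\ell(T)-s(T)-sl(T)}{2}.\]
   Context: For an undirected graph $G=(V,E)$, $S\subseteq V$ is a locating-dominating set if every $u\notin S$ has $N(u)\cap S\neq\emptyset$ and distinct $u,v\notin S$ satisfy $N(u)\cap S\neq N(v)\cap S$; $\gamma_{LD}(G)$ is the minimum size. A leaf is a vertex of degree 1; a support vertex is a vertex adjacent to a leaf; a support link is a vertex that is neither a leaf nor a support vertex and all of whose neighbours are support vertices. $\ell(T)$, $s(T)$, $sl(T)$ denote the numbers of leaves, support vertices and support links of $T$. By convention, for the path $P_2$ one of its vertices is considered a support vertex and the other a leaf. -}

module Defs where

open import Data.Nat using (ℕ; zero; suc; _+_; _*_; _∸_; _≡ᵇ_; _<ᵇ_)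
open import Data.Bool using (Bool; true; false; _∧_; not; if_then_else_)
open import Data.Fin using (Fin; toℕ)
open import Data.List using (List; allFin; map)
open import Data.Nat.ListAction using (sum)
import Data.Bool.ListAction as BL
open import Data.Product using (Σ; _×_; _,_)
open import Relation.Binary.PropositionalEquality using (_≡_; _≢_)
open import Relation.Nullary using (¬_)
open import Relation.Binary.Construct.Closure.ReflexiveTransitive using (Star)

record Graph (n : ℕ) : Set where
  field
    adj   : Fin n → Fin n → Bool
    sym   : ∀ u v → adj u v ≡ adj v u
    irref : ∀ u → adj u u ≡ false
open Graph public

count : ∀ {n} → (Fin n → Bool) → ℕ
count {n} p = sum (map (λ i → if p i then 1 else 0) (allFin n))

allᵇ : ∀ {n} → (Fin n → Bool) → Bool
allᵇ {n} p = BL.all p (allFin n)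

anyᵇ : ∀ {n} → (Fin n → Bool) → Bool
anyᵇ {n} p = BL.any p (allFin n)

module _ {n : ℕ} (G : Graph n) where

  degree : Fin n → ℕ
  degree u = count (adj G u)

  edgeCount : ℕ
  edgeCount = sum (map (λ i → count (λ j → (toℕ i <ᵇ toℕ j) ∧ adj G i j)) (allFin n))

  Connected : Set
  Connected = ∀ u v → Star (λ x y → adj G x y ≡ true) u v

  IsTree : Set
  IsTree = Connected × (edgeCount + 1 ≡ n)

  isLeaf : Fin n → Bool
  isLeaf u = degree u ≡ᵇ 1

  isSupport : Fin n → Bool
  isSupport u = anyᵇ (λ v → adj G u v ∧ isLeaf v)

  isSupportLink : Fin n → Bool
  isSupportLink u =
    not (isLeaf u) ∧ not (isSupport u) ∧ allᵇ (λ v → not (adj G u v) Data.Bool.∨ isSupport v)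

  leaves supports supportLinks : ℕ
  leaves       = count isLeaf
  supports     = count isSupport
  supportLinks = count isSupportLink

  IsLocatingDominating : (Fin n → Bool) → Set
  IsLocatingDominating S =
      (∀ u → S u ≡ false → Σ (Fin n) (λ w → S w ≡ true × adj G u w ≡ true))
    × (∀ u v → S u ≡ false → S v ≡ false → u ≢ v →
         ¬ (∀ w → (S w ∧ adj G u w) ≡ (S w ∧ adj G v w)))

-- Fix a proper 2-colouring of the tree. For a colour class C let S_C consist of all support
-- vertices, all leaves except one retained leaf at each support vertex, and the vertices of C
-- that are neither leaves, support vertices nor support links. A vertex outside S_C is either a
-- retained leaf, whose support vertex lies in S_C, or has at least two neighbours, all in S_C;
-- as a tree has no 4-cycle, distinct such vertices have distinct neighbourhoods in S_C.
-- Counting vertex by vertex, |S_C| + |S_C'| + sl = n + ℓ + s − 2k ≤ n + ℓ − s, where k ≥ s is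
-- the number of retained leaves, so the smaller of S_C and S_C' satisfies the bound.
-- Bipartiteness and C4-freeness of trees follow by stripping leaves one at a time.

module Submission where

open import Defs
open import Data.Bool using (Bool; true; false; _∧_; _∨_; not; if_then_else_; T)
open import Data.Bool.Properties using (∧-conicalˡ; ∧-conicalʳ; ∧-zeroʳ; not-involutive; ¬-not; T-≡; T-not-≡)
import Data.Bool.Properties as Bool
open import Data.Empty using (⊥)
open import Data.Fin using (Fin; zero; suc; toℕ)
open import Data.Fin.Properties using (_≟_; any?; toℕ-injective)
import Data.Fin.Properties as Fin
open import Data.List using (allFin; map; tabulate)
open import Data.List.Membership.Propositional using (lose)
open import Data.List.Membership.Propositional.Properties using (∈-allFin)
open import Data.List.Properties using (map-tabulate)
import Data.List.Relation.Unary.All as All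
open import Data.List.Relation.Unary.All.Properties using (all⁺)
open import Data.List.Relation.Unary.Any using (satisfied)
open import Data.List.Relation.Unary.Any.Properties using (any⁺; any⁻)
open import Data.Nat using (ℕ; zero; suc; _+_; _*_; _≤_; _<_; _<ᵇ_; z≤n; s≤s; s≤s⁻¹)
import Data.Nat.ListAction as List
open import Data.Nat.Properties
  using ( suc-injective; +-comm; +-assoc; +-suc; +-identityʳ; +-cancelˡ-≡; ≤-reflexive; ≤-trans; ≤-antisym; ≤-total
        ; +-mono-≤; +-monoˡ-≤; +-monoʳ-≤; +-mono-<; +-cancelʳ-≤; ≤⇒≯; ≮⇒≥; ≤∧≢⇒<; n<1+n; <-cmp
        ; ≡ᵇ⇒≡; ≡⇒≡ᵇ; <ᵇ⇒<; <⇒<ᵇ )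
import Data.Nat.Properties as ℕ
open import Data.Nat.Tactic.RingSolver using (solve-∀)
open import Data.Product using (Σ; _×_; _,_; proj₁; proj₂; ∃; ∃₂)
import Data.Product as Product
open import Data.Sum using (_⊎_; inj₁; inj₂)
import Data.Sum as Sum
open import Function using (Equivalence; _∘_; case_of_)
open import Relation.Binary.Construct.Closure.ReflexiveTransitive using (Star; ε; _◅_)
open import Relation.Binary.Definitions using (tri<; tri≈; tri>)
open import Relation.Binary.PropositionalEquality as ≡
  using (_≡_; _≢_; ≢-sym; refl; trans; cong; cong₂; subst; subst₂; module ≡-Reasoning)
open import Relation.Nullary using (¬_; Dec; does; yes; no; contradiction)
open import Relation.Nullary.Decidable using (dec-true; dec-false)

open import Algebra.Properties.CommutativeSemigroup ℕ.+-commutativeSemigroup using (x∙yz≈y∙xz)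
open import Algebra.Properties.CommutativeMonoid.Sum ℕ.+-0-commutativeMonoid
  using (sum-cong-≗; ∑-distrib-+; ∑-comm) renaming (sum to ∑)

open ≡-Reasoning

-- Counting over Fin n

T⇒≡ : ∀ {b} → T b → b ≡ true
T⇒≡ = Equivalence.to T-≡

≡⇒T : ∀ {b} → b ≡ true → T b
≡⇒T = Equivalence.from T-≡

not-true : ∀ {b} → not b ≡ true → b ≡ false
not-true = Equivalence.to T-not-≡ ∘ ≡⇒T

<ᵇ-false : ∀ {m n} → ¬ m < n → (m <ᵇ n) ≡ false
<ᵇ-false {m} {n} m≮n = ¬-not (λ e → m≮n (<ᵇ⇒< m n (≡⇒T e)))

ind : Bool → ℕ
ind b = if b then 1 else 0

sum-tabulate : ∀ {n} (f : Fin n → ℕ) → List.sum (tabulate f) ≡ ∑ f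
sum-tabulate {zero}  f = refl
sum-tabulate {suc n} f = cong (f zero +_) (sum-tabulate (λ i → f (suc i)))

sum-allFin : ∀ {n} (f : Fin n → ℕ) → List.sum (map f (allFin n)) ≡ ∑ f
sum-allFin f = trans (cong List.sum (map-tabulate (λ i → i) f)) (sum-tabulate f)

count≡∑ : ∀ {n} (p : Fin n → Bool) → count p ≡ ∑ (λ i → ind (p i))
count≡∑ p = sum-allFin (λ i → ind (p i))

count-+ : ∀ {n} (p q : Fin n → Bool) → count p + count q ≡ ∑ (λ i → ind (p i) + ind (q i))
count-+ p q = trans (cong₂ _+_ (count≡∑ p) (count≡∑ q)) (≡.sym (∑-distrib-+ (λ i → ind (p i)) (λ i → ind (q i))))

count-suc : ∀ {n} (p : Fin (suc n) → Bool) → count p ≡ ind (p zero) + count (λ i → p (suc i))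
count-suc p = trans (count≡∑ p) (cong (ind (p zero) +_) (≡.sym (count≡∑ (λ i → p (suc i)))))


∑-mono-≤ : ∀ {n} {f g : Fin n → ℕ} → (∀ i → f i ≤ g i) → ∑ f ≤ ∑ g
∑-mono-≤ {zero}  f≤g = z≤n
∑-mono-≤ {suc n} f≤g = +-mono-≤ (f≤g zero) (∑-mono-≤ (f≤g ∘ suc))

count-cong : ∀ {n} {p q : Fin n → Bool} → (∀ i → p i ≡ q i) → count p ≡ count q
count-cong {p = p} {q} p≗q = begin
  count p                ≡⟨ count≡∑ p ⟩
  ∑ (λ i → ind (p i))    ≡⟨ sum-cong-≗ (λ i → cong ind (p≗q i)) ⟩
  ∑ (λ i → ind (q i))    ≡⟨ ≡.sym (count≡∑ q) ⟩
  count q                ∎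

count-false : ∀ {n} → count {n} (λ _ → false) ≡ 0
count-false {zero}  = refl
count-false {suc n} = trans (count-suc {n} (λ _ → false)) (count-false {n})

count-true : ∀ {n} → count {n} (λ _ → true) ≡ n
count-true {zero}  = refl
count-true {suc n} = trans (count-suc {n} (λ _ → true)) (cong suc (count-true {n}))

count-suc-true : ∀ {n} (p : Fin (suc n) → Bool) → p zero ≡ true → count p ≡ suc (count (λ i → p (suc i)))
count-suc-true p p0 = trans (count-suc p) (cong (λ b → ind b + count (λ i → p (suc i))) p0)

count-suc-false : ∀ {n} (p : Fin (suc n) → Bool) → p zero ≡ false → count p ≡ count (λ i → p (suc i))
count-suc-false p p0 = trans (count-suc p) (cong (λ b → ind b + count (λ i → p (suc i))) p0)

-- `does`, unlike `⌊_⌋`, computes, so that `(p ∖ suc a) (suc i)` reduces to `((p ∘ suc) ∖ a) i`.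
_∖_ : ∀ {n} → (Fin n → Bool) → Fin n → Fin n → Bool
(p ∖ a) i = not (does (i ≟ a)) ∧ p i

count-split : ∀ {n} (p : Fin n → Bool) a → count p ≡ ind (p a) + count (p ∖ a)
count-split {suc n} p zero = trans (count-suc p) (cong (ind (p zero) +_) (≡.sym (count-suc (p ∖ zero))))
count-split {suc n} p (suc a) = begin
  count p                                                   ≡⟨ count-suc p ⟩
  ind (p zero) + count (p ∘ suc)                            ≡⟨ cong (ind (p zero) +_) (count-split (p ∘ suc) a) ⟩
  ind (p zero) + (ind (p (suc a)) + count ((p ∘ suc) ∖ a))  ≡⟨ x∙yz≈y∙xz (ind (p zero)) (ind (p (suc a))) _ ⟩
  ind (p (suc a)) + (ind (p zero) + count ((p ∘ suc) ∖ a))  ≡⟨ cong (ind (p (suc a)) +_) (≡.sym (count-suc (p ∖ suc a))) ⟩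
  ind (p (suc a)) + count (p ∖ suc a)                       ∎

count-remove : ∀ {n} (p : Fin n → Bool) {a} → p a ≡ true → count p ≡ suc (count (p ∖ a))
count-remove p {a} pa = trans (count-split p a) (cong (λ b → ind b + count (p ∖ a)) pa)

∖-intro : ∀ {n} {p : Fin n → Bool} {a b} → p b ≡ true → b ≢ a → (p ∖ a) b ≡ true
∖-intro {a = a} {b} pb b≢a = cong₂ (λ d x → not d ∧ x) (dec-false (b ≟ a) b≢a) pb

∖-elim : ∀ {n} {p : Fin n → Bool} {a b} → (p ∖ a) b ≡ true → p b ≡ true × b ≢ a
∖-elim {p = p} {a} {b} q = ∧-conicalʳ _ _ q , λ b≡a →
  contradiction (trans (≡.sym q) (cong (λ d → not d ∧ p b) (dec-true (b ≟ a) b≡a))) λ ()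

count-none : ∀ {n} {p : Fin n → Bool} → (∀ i → p i ≡ false) → count p ≡ 0
count-none {n} none = trans (count-cong none) (count-false {n})

count-witness : ∀ {n} (p : Fin n → Bool) → 1 ≤ count p → ∃ λ i → p i ≡ true
count-witness p h with any? (λ i → p i Bool.≟ true)
... | yes w = w
... | no ∄ = contradiction (subst (1 ≤_) (count-none (λ i → ¬-not (λ pi → ∄ (i , pi)))) h) λ ()

count-unique : ∀ {n} {p : Fin n → Bool} {a b} → count p ≡ 1 → p a ≡ true → p b ≡ true → b ≡ a
count-unique {p = p} {a} {b} c pa pb with b ≟ a
... | yes b≡a = b≡a
... | no b≢a = contradiction (trans (≡.sym (count-remove (p ∖ a) (∖-intro {p = p} pb b≢a))) count-rest) λ ()
  where
  count-rest : count (p ∖ a) ≡ 0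
  count-rest = suc-injective (trans (≡.sym (count-remove p pa)) c)

count-two : ∀ {n} (p : Fin n → Bool) → 2 ≤ count p → ∃₂ λ a b → b ≢ a × p a ≡ true × p b ≡ true
count-two p h with count-witness p (≤-trans (s≤s z≤n) h)
... | a , pa with count-witness (p ∖ a) (s≤s⁻¹ (subst (2 ≤_) (count-remove p pa) h))
... | b , qb = a , b , proj₂ (∖-elim {p = p} qb) , pa , proj₁ (∖-elim {p = p} qb)

count-injective : ∀ {k n} {p : Fin k → Bool} {q : Fin n → Bool} (f : Fin k → Fin n) →
                  (∀ {i} → p i ≡ true → q (f i) ≡ true) →
                  (∀ {i j} → p i ≡ true → p j ≡ true → f i ≡ f j → i ≡ j) →
                  count p ≤ count q
count-injective {zero} f maps inj = z≤n
count-injective {suc k} {p = p} {q} f maps inj with p zero Bool.≟ true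
... | no ¬p0 = subst (_≤ count q) (≡.sym (count-suc-false p (¬-not ¬p0)))
  (count-injective (λ i → f (suc i)) maps (λ pi pj e → Fin.suc-injective (inj pi pj e)))
... | yes p0 = subst₂ _≤_ (≡.sym (count-suc-true p p0)) (≡.sym (count-remove q (maps p0)))
  (s≤s (count-injective (λ i → f (suc i))
    (λ pi → ∖-intro {p = q} (maps pi) (λ e → contradiction (inj p0 pi (≡.sym e)) λ ()))
    (λ pi pj e → Fin.suc-injective (inj pi pj e))))

count-singleton : ∀ {n} (a : Fin n) → count (λ i → does (i ≟ a)) ≡ 1
count-singleton a = trans (count-remove (λ i → does (i ≟ a)) (dec-true (a ≟ a) refl)) (cong suc (count-none not-a))
  where
  not-a : ∀ i → not (does (i ≟ a)) ∧ does (i ≟ a) ≡ false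
  not-a i with does (i ≟ a)
  ... | true  = refl
  ... | false = refl

anyᵇ-intro : ∀ {n} {p : Fin n → Bool} {i} → p i ≡ true → anyᵇ p ≡ true
anyᵇ-intro {n} {p} {i} pi = T⇒≡ (any⁺ p (lose (∈-allFin i) (≡⇒T pi)))

anyᵇ-elim : ∀ {n} {p : Fin n → Bool} → anyᵇ p ≡ true → ∃ λ i → p i ≡ true
anyᵇ-elim {n} {p} h = Product.map₂ T⇒≡ (satisfied (any⁻ p (allFin n) (≡⇒T h)))

allᵇ-elim : ∀ {n} {p : Fin n → Bool} → allᵇ p ≡ true → ∀ i → p i ≡ true
allᵇ-elim {n} {p} h i = T⇒≡ (All.lookup (all⁺ p (allFin n) (≡⇒T h)) (∈-allFin i))

module _ {n : ℕ} (G : Graph n) where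

  Adj : Fin n → Fin n → Set
  Adj u v = adj G u v ≡ true

  Adj-sym : ∀ {u v} → Adj u v → Adj v u
  Adj-sym {u} {v} e = trans (Graph.sym G v u) e

  Adj-irrefl : ∀ {u v} → Adj u v → v ≢ u
  Adj-irrefl {u} e refl = contradiction (trans (≡.sym e) (irref G u)) λ ()

  degree-pos : ∀ {u v} → Adj u v → 1 ≤ degree G u
  degree-pos {u} e = subst (1 ≤_) (≡.sym (count-remove (adj G u) e)) (s≤s z≤n)

  neighbour : ∀ {u} → 1 ≤ degree G u → ∃ (Adj u)
  neighbour {u} = count-witness (adj G u)

  degree1-unique : ∀ {u v w} → degree G u ≡ 1 → Adj u v → Adj u w → w ≡ v
  degree1-unique = count-unique

  two-neighbours : ∀ {u} → 2 ≤ degree G u → ∃₂ λ a b → b ≢ a × Adj u a × Adj u b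
  two-neighbours {u} = count-two (adj G u)

  leaf⇒degree1 : ∀ {u} → isLeaf G u ≡ true → degree G u ≡ 1
  leaf⇒degree1 {u} l = ≡ᵇ⇒≡ (degree G u) 1 (≡⇒T l)

  degree1⇒leaf : ∀ {u} → degree G u ≡ 1 → isLeaf G u ≡ true
  degree1⇒leaf {u} d = T⇒≡ (≡⇒≡ᵇ (degree G u) 1 d)

  support-intro : ∀ {u v} → Adj u v → isLeaf G v ≡ true → isSupport G u ≡ true
  support-intro {u} e l = anyᵇ-intro {p = λ w → adj G u w ∧ isLeaf G w} (cong₂ _∧_ e l)

  support-elim : ∀ {u} → isSupport G u ≡ true → ∃ λ v → Adj u v × isLeaf G v ≡ true
  support-elim s = Product.map₂ (λ q → ∧-conicalˡ _ _ q , ∧-conicalʳ _ _ q) (anyᵇ-elim s)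

  supportLink-elim : ∀ {u} → isSupportLink G u ≡ true →
                     isLeaf G u ≡ false × isSupport G u ≡ false × (∀ {v} → Adj u v → isSupport G v ≡ true)
  supportLink-elim {u} s = not-true (∧-conicalˡ _ _ s) , not-true (∧-conicalˡ _ _ rest) , neighbours-support
    where
    rest = ∧-conicalʳ (not (isLeaf G u)) _ s
    neighbours-support : ∀ {v} → Adj u v → isSupport G v ≡ true
    neighbours-support {v} e with allᵇ-elim (∧-conicalʳ (not (isSupport G u)) _ rest) v
    ... | q rewrite e = q

  isNonIsolated : Fin n → Bool
  isNonIsolated u = 0 <ᵇ degree G u

  nonIsolated-intro : ∀ {u v} → Adj u v → isNonIsolated u ≡ true
  nonIsolated-intro e = T⇒≡ (<⇒<ᵇ (degree-pos e))

  nonIsolated-elim : ∀ {u} → isNonIsolated u ≡ true → ∃ (Adj u)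
  nonIsolated-elim {u} h = neighbour (<ᵇ⇒< 0 (degree G u) (≡⇒T h))

  degreeSum : ℕ
  degreeSum = ∑ (degree G)

  handshake : degreeSum ≡ edgeCount G + edgeCount G
  handshake = begin
    ∑ (degree G)                                         ≡⟨ sum-cong-≗ (λ i → count≡∑ (adj G i)) ⟩
    ∑ (λ i → ∑ (λ j → ind (adj G i j)))                  ≡⟨ sum-cong-≗ (λ i → sum-cong-≗ (split i)) ⟩
    ∑ (λ i → ∑ (λ j → A i j + A j i))                    ≡⟨ sum-cong-≗ (λ i → ∑-distrib-+ (A i) (λ j → A j i)) ⟩
    ∑ (λ i → ∑ (A i) + ∑ (λ j → A j i))                  ≡⟨ ∑-distrib-+ (λ i → ∑ (A i)) _ ⟩
    ∑ (λ i → ∑ (A i)) + ∑ (λ i → ∑ (λ j → A j i))        ≡⟨ cong (∑ (λ i → ∑ (A i)) +_) (∑-comm (λ i j → A j i)) ⟩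
    ∑ (λ i → ∑ (A i)) + ∑ (λ j → ∑ (λ i → A j i))        ≡⟨ cong₂ _+_ edgeCount≡ edgeCount≡ ⟩
    edgeCount G + edgeCount G                            ∎
    where
    lt : Fin n → Fin n → Bool
    lt i j = toℕ i <ᵇ toℕ j
    A : Fin n → Fin n → ℕ
    A i j = ind (lt i j ∧ adj G i j)
    edgeCount≡ : ∑ (λ i → ∑ (A i)) ≡ edgeCount G
    edgeCount≡ = ≡.sym (trans (sum-allFin (λ i → count (λ j → lt i j ∧ adj G i j)))
                              (sum-cong-≗ (λ i → count≡∑ (λ j → lt i j ∧ adj G i j))))
    split : ∀ i j → ind (adj G i j) ≡ A i j + A j i
    split i j with <-cmp (toℕ i) (toℕ j)
    ... | tri< i<j _ j≮i rewrite T⇒≡ (<⇒<ᵇ i<j) | <ᵇ-false j≮i = ≡.sym (+-identityʳ _)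
    ... | tri> i≮j _ j<i rewrite T⇒≡ (<⇒<ᵇ j<i) | <ᵇ-false i≮j = cong ind (Graph.sym G i j)
    ... | tri≈ _ i≡j _ rewrite toℕ-injective i≡j | irref G j | ∧-zeroʳ (lt j j) = refl

does-false⇒≢ : ∀ {n} {u x : Fin n} → does (u ≟ x) ≡ false → u ≢ x
does-false⇒≢ {u = u} {x} d u≡x = contradiction (trans (≡.sym (dec-true (u ≟ x) u≡x)) d) λ ()

guard-comm : ∀ a b {c d} → c ≡ d → a ∧ (b ∧ c) ≡ b ∧ (a ∧ d)
guard-comm true  true  c≡d = c≡d
guard-comm true  false _   = refl
guard-comm false true  _   = refl
guard-comm false false _   = refl

-- Deleting a vertex is modelled by deleting its edges, which keeps the vertex set Fin n.
isolate : ∀ {n} → Graph n → Fin n → Graph n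
isolate G x = record
  { adj   = λ u v → not (does (u ≟ x)) ∧ (not (does (v ≟ x)) ∧ adj G u v)
  ; sym   = λ u v → guard-comm (not (does (u ≟ x))) (not (does (v ≟ x))) (Graph.sym G u v)
  ; irref = λ u → trans (cong (λ b → not (does (u ≟ x)) ∧ (not (does (u ≟ x)) ∧ b)) (irref G u))
                        (trans (cong (not (does (u ≟ x)) ∧_) (∧-zeroʳ _)) (∧-zeroʳ _))
  }

module _ {n : ℕ} (G : Graph n) (x : Fin n) where

  isolate-⊆ : ∀ {u v} → Adj (isolate G x) u v → Adj G u v
  isolate-⊆ {u} {v} e = ∧-conicalʳ (not (does (v ≟ x))) _ (∧-conicalʳ (not (does (u ≟ x))) _ e)

  isolate-≢ : ∀ {u v} → Adj (isolate G x) u v → u ≢ x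
  isolate-≢ {u} e = does-false⇒≢ (not-true (∧-conicalˡ (not (does (u ≟ x))) _ e))

  isolate-keeps : ∀ {u v} → u ≢ x → v ≢ x → Adj G u v → Adj (isolate G x) u v
  isolate-keeps {u} {v} u≢x v≢x e =
    cong₂ _∧_ (cong not (dec-false (u ≟ x) u≢x)) (cong₂ _∧_ (cong not (dec-false (v ≟ x) v≢x)) e)

  degree-isolate-self : degree (isolate G x) x ≡ 0
  degree-isolate-self =
    count-none (λ v → cong (λ d → not d ∧ (not (does (v ≟ x)) ∧ adj G x v)) (dec-true (x ≟ x) refl))

  degree-isolate : ∀ {u} → u ≢ x → degree G u ≡ ind (adj G u x) + degree (isolate G x) u
  degree-isolate {u} u≢x = trans (count-split (adj G u) x) (cong (ind (adj G u x) +_) (count-cong unguard))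
    where
    unguard : ∀ v → (adj G u ∖ x) v ≡ adj (isolate G x) u v
    unguard v = ≡.sym (cong (λ d → not d ∧ (adj G u ∖ x) v) (dec-false (u ≟ x) u≢x))

  degreeSum-isolate-leaf : degree G x ≡ 1 → degreeSum G ≡ suc (suc (degreeSum (isolate G x)))
  degreeSum-isolate-leaf leaf = begin
    ∑ (degree G)                                              ≡⟨ sum-cong-≗ (λ i → split i (i ≟ x)) ⟩
    ∑ (λ i → degree (isolate G x) i + ind (adj G i x) + ind (does (i ≟ x)))
      ≡⟨ ∑-distrib-+ (λ i → degree (isolate G x) i + ind (adj G i x)) (λ i → ind (does (i ≟ x))) ⟩
    ∑ (λ i → degree (isolate G x) i + ind (adj G i x)) + ∑ (λ i → ind (does (i ≟ x)))
      ≡⟨ cong₂ _+_ (∑-distrib-+ (degree (isolate G x)) (λ i → ind (adj G i x)))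
                   (≡.sym (count≡∑ (λ i → does (i ≟ x)))) ⟩
    degreeSum (isolate G x) + ∑ (λ i → ind (adj G i x)) + count (λ i → does (i ≟ x))
      ≡⟨ cong₂ (λ a b → degreeSum (isolate G x) + a + b) column (count-singleton x) ⟩
    degreeSum (isolate G x) + 1 + 1                           ≡⟨ +-comm (degreeSum (isolate G x) + 1) 1 ⟩
    suc (degreeSum (isolate G x) + 1)                         ≡⟨ cong suc (+-comm _ 1) ⟩
    suc (suc (degreeSum (isolate G x)))                       ∎
    where
    column : ∑ (λ i → ind (adj G i x)) ≡ 1
    column = trans (≡.sym (count≡∑ (λ i → adj G i x))) (trans (count-cong (λ i → Graph.sym G i x)) leaf)
    split : ∀ i → Dec (i ≡ x) → degree G i ≡ degree (isolate G x) i + ind (adj G i x) + ind (does (i ≟ x))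
    split i (yes refl) = trans leaf (≡.sym (cong₂ _+_
      (cong₂ (λ d a → d + ind a) degree-isolate-self (irref G x)) (cong ind (dec-true (x ≟ x) refl))))
    split i (no i≢x) = begin
      degree G i                                                      ≡⟨ degree-isolate i≢x ⟩
      ind (adj G i x) + degree (isolate G x) i                        ≡⟨ +-comm (ind (adj G i x)) _ ⟩
      degree (isolate G x) i + ind (adj G i x)                        ≡⟨ +-identityʳ _ ⟨
      degree (isolate G x) i + ind (adj G i x) + ind false            ≡⟨ cong (λ b → degree (isolate G x) i + ind (adj G i x) + ind b)
                                                                           (dec-false (i ≟ x) i≢x) ⟨
      degree (isolate G x) i + ind (adj G i x) + ind (does (i ≟ x))   ∎

-- Trees are bipartite and C4-free

module _ {n : ℕ} (G : Graph n) where

  Walk : Fin n → Fin n → Set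
  Walk = Star (Adj G)

  first-step : ∀ {u v} → Walk u v → v ≢ u → ∃ (Adj G u)
  first-step ε        v≢u = contradiction refl v≢u
  first-step (e ◅ _)  _   = _ , e

  Bipartite : Set
  Bipartite = ∃ λ (colour : Fin n → Bool) → ∀ {u v} → Adj G u v → colour v ≡ not (colour u)

  C4Free : Set
  C4Free = ∀ {u v a b} → v ≢ u → b ≢ a → Adj G u a → Adj G u b → Adj G v a → Adj G v b → ⊥

  NonIsolatedConnected : Set
  NonIsolatedConnected = ∀ {u v} → isNonIsolated G u ≡ true → isNonIsolated G v ≡ true → Walk u v

  edgeless⇒bipartite×c4Free : (∀ {u v} → ¬ Adj G u v) → Bipartite × C4Free
  edgeless⇒bipartite×c4Free no-edge = ((λ _ → true) , λ e → contradiction e no-edge) , λ _ _ e → contradiction e no-edge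

  count-nonIsolated-≤ : count (isNonIsolated G) ≤ degreeSum G
  count-nonIsolated-≤ =
    subst (_≤ degreeSum G) (≡.sym (count≡∑ (isNonIsolated G))) (∑-mono-≤ (λ i → positive-≤ (degree G i)))
    where
    positive-≤ : ∀ d → ind (0 <ᵇ d) ≤ d
    positive-≤ zero    = z≤n
    positive-≤ (suc d) = s≤s z≤n

  leaf-exists : degreeSum G < count (isNonIsolated G) + count (isNonIsolated G) → ∃ λ x → degree G x ≡ 1
  leaf-exists small with any? (λ x → degree G x ℕ.≟ 1)
  ... | yes leaf = leaf
  ... | no ∄ = contradiction small (≤⇒≯ (≤-trans (≤-reflexive (count-+ (isNonIsolated G) (isNonIsolated G)))
                 (∑-mono-≤ (λ i → twice-positive-≤ (degree G i) (λ d≡1 → ∄ (i , d≡1))))))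
    where
    twice-positive-≤ : ∀ d → d ≢ 1 → ind (0 <ᵇ d) + ind (0 <ᵇ d) ≤ d
    twice-positive-≤ zero          _   = z≤n
    twice-positive-≤ (suc zero)    d≢1 = contradiction refl d≢1
    twice-positive-≤ (suc (suc d)) _   = s≤s (s≤s z≤n)

-- The invariant of leaf stripping: the non-isolated vertices span a tree with k edges.
record NonIsolatedTree {n} (k : ℕ) (G : Graph n) : Set where
  field
    degreeSum≡ : degreeSum G ≡ k + k
    connected  : NonIsolatedConnected G
    count≡     : count (isNonIsolated G) ≡ suc k

module _ {n : ℕ} (G : Graph n) {x p : Fin n} (leaf : degree G x ≡ 1) (xp : Adj G x p) where

  leaf-neighbour : ∀ {v} → Adj G x v → v ≡ p
  leaf-neighbour = degree1-unique G leaf xp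

  bipartite-isolate-leaf : Bipartite (isolate G x) → Bipartite G
  bipartite-isolate-leaf (colour , proper) = colour′ , proper′
    where
    colour′ : Fin n → Bool
    colour′ i = if does (i ≟ x) then not (colour p) else colour i
    proper′ : ∀ {u v} → Adj G u v → colour′ v ≡ not (colour′ u)
    proper′ {u} {v} e with u ≟ x | v ≟ x
    ... | yes refl | yes refl = contradiction refl (Adj-irrefl G e)
    ... | yes refl | no _     = trans (cong colour (leaf-neighbour e)) (≡.sym (not-involutive (colour p)))
    ... | no _     | yes refl = cong (not ∘ colour) (≡.sym (leaf-neighbour (Adj-sym G e)))
    ... | no u≢x   | no v≢x   = proper (isolate-keeps G x u≢x v≢x e)

  c4Free-isolate-leaf : C4Free (isolate G x) → C4Free G
  c4Free-isolate-leaf c4 {u} {v} {a} {b} v≢u b≢a ua ub va vb with u ≟ x | v ≟ x | a ≟ x | b ≟ x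
  ... | yes refl | _ | _ | _ = b≢a (trans (leaf-neighbour ub) (≡.sym (leaf-neighbour ua)))
  ... | _ | yes refl | _ | _ = b≢a (trans (leaf-neighbour vb) (≡.sym (leaf-neighbour va)))
  ... | _ | _ | yes refl | _ = v≢u (trans (leaf-neighbour (Adj-sym G va)) (≡.sym (leaf-neighbour (Adj-sym G ua))))
  ... | _ | _ | _ | yes refl = v≢u (trans (leaf-neighbour (Adj-sym G vb)) (≡.sym (leaf-neighbour (Adj-sym G ub))))
  ... | no u≢x | no v≢x | no a≢x | no b≢x =
    c4 v≢u b≢a (keep u≢x a≢x ua) (keep u≢x b≢x ub) (keep v≢x a≢x va) (keep v≢x b≢x vb)
    where keep = isolate-keeps G x

  leaf-pair-closed : degree G p ≡ 1 → ∀ {u v} → Walk G u v → u ≡ x ⊎ u ≡ p → v ≡ x ⊎ v ≡ p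
  leaf-pair-closed _     ε          u∈xp          = u∈xp
  leaf-pair-closed p-leaf (e ◅ walk) (inj₁ refl) = leaf-pair-closed p-leaf walk (inj₂ (leaf-neighbour e))
  leaf-pair-closed p-leaf (e ◅ walk) (inj₂ refl) =
    leaf-pair-closed p-leaf walk (inj₁ (degree1-unique G p-leaf (Adj-sym G xp) e))

  isolate-leaf-pair-edgeless : NonIsolatedConnected G → degree G p ≡ 1 → ∀ {u v} → ¬ Adj (isolate G x) u v
  isolate-leaf-pair-edgeless connected p-leaf {u} {v} e =
    Adj-irrefl G (isolate-⊆ G x {u} {v} e) (trans (is-p {v} {u} (Adj-sym (isolate G x) {u} {v} e)) (≡.sym (is-p {u} {v} e)))
    where
    is-p : ∀ {w y} → Adj (isolate G x) w y → w ≡ p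
    is-p {w} {y} e′ with leaf-pair-closed p-leaf
           (connected (nonIsolated-intro G xp) (nonIsolated-intro G (isolate-⊆ G x {w} {y} e′))) (inj₁ refl)
    ... | inj₁ w≡x = contradiction w≡x (isolate-≢ G x {w} {y} e′)
    ... | inj₂ w≡p = w≡p

  redirect : Fin n → Fin n
  redirect i = if does (i ≟ x) then p else i

  redirect-≢ : ∀ {i} → i ≢ x → redirect i ≡ i
  redirect-≢ {i} i≢x = cong (λ d → if d then p else i) (dec-false (i ≟ x) i≢x)

  walk-isolate-leaf : ∀ {u v} → Walk G u v → Walk (isolate G x) (redirect u) (redirect v)
  walk-isolate-leaf ε = ε
  walk-isolate-leaf {u} {v} (_◅_ {j = w} e walk) with u ≟ x | w ≟ x | walk-isolate-leaf walk
  ... | yes refl | yes refl | _    = contradiction refl (Adj-irrefl G e)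
  ... | yes refl | no w≢x   | rest = subst (λ y → Walk (isolate G x) y (redirect v)) (leaf-neighbour e) rest
  ... | no u≢x   | yes refl | rest =
    subst (λ y → Walk (isolate G x) y (redirect v)) (≡.sym (leaf-neighbour (Adj-sym G e))) rest
  ... | no u≢x   | no w≢x   | rest = isolate-keeps G x u≢x w≢x e ◅ rest

  connected-isolate-leaf : NonIsolatedConnected G → NonIsolatedConnected (isolate G x)
  connected-isolate-leaf connected {u} {v} hu hv =
    subst₂ (Walk (isolate G x)) (redirect-≢ {u} u≢x) (redirect-≢ {v} v≢x) (walk-isolate-leaf (connected hu′ hv′))
    where
    in-G : ∀ {w} → isNonIsolated (isolate G x) w ≡ true → w ≢ x × isNonIsolated G w ≡ true
    in-G {w} h with nonIsolated-elim (isolate G x) {w} h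
    ... | y , e = isolate-≢ G x {w} {y} e , nonIsolated-intro G (isolate-⊆ G x {w} {y} e)
    u≢x = proj₁ (in-G {u} hu)
    v≢x = proj₁ (in-G {v} hv)
    hu′ = proj₂ (in-G {u} hu)
    hv′ = proj₂ (in-G {v} hv)

  count-nonIsolated-isolate-leaf : 2 ≤ degree G p →
    count (isNonIsolated G) ≡ suc (count (isNonIsolated (isolate G x)))
  count-nonIsolated-isolate-leaf p-branch =
    trans (count-remove (isNonIsolated G) (nonIsolated-intro G xp)) (cong suc (count-cong (λ i → by-cases i (i ≟ x))))
    where
    positive-shift : ∀ b d → (b ≡ true → 1 ≤ d) → (0 <ᵇ (ind b + d)) ≡ (0 <ᵇ d)
    positive-shift false d       _   = refl
    positive-shift true  (suc d) _   = refl
    positive-shift true  zero    pos = contradiction (pos refl) λ ()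
    by-cases : ∀ i → Dec (i ≡ x) → (isNonIsolated G ∖ x) i ≡ isNonIsolated (isolate G x) i
    by-cases i (yes refl) = trans (cong (λ d → not d ∧ isNonIsolated G x) (dec-true (x ≟ x) refl))
                                  (≡.sym (cong (0 <ᵇ_) (degree-isolate-self G x)))
    by-cases i (no i≢x) = begin
      not (does (i ≟ x)) ∧ isNonIsolated G i           ≡⟨ cong (λ d → not d ∧ isNonIsolated G i) (dec-false (i ≟ x) i≢x) ⟩
      0 <ᵇ degree G i                                  ≡⟨ cong (0 <ᵇ_) (degree-isolate G x i≢x) ⟩
      0 <ᵇ (ind (adj G i x) + degree (isolate G x) i)  ≡⟨ positive-shift (adj G i x) _ still-adjacent ⟩
      0 <ᵇ degree (isolate G x) i                      ∎
      where
      still-adjacent : adj G i x ≡ true → 1 ≤ degree (isolate G x) i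
      still-adjacent ix with leaf-neighbour (Adj-sym G ix)
      ... | refl = s≤s⁻¹ (subst (2 ≤_) degree-p p-branch)
        where
        degree-p : degree G p ≡ suc (degree (isolate G x) p)
        degree-p = trans (degree-isolate G x i≢x) (cong (λ b → ind b + degree (isolate G x) p) ix)

  nonIsolatedTree-isolate-leaf : ∀ {k} → NonIsolatedTree (suc k) G → 2 ≤ degree G p → NonIsolatedTree k (isolate G x)
  nonIsolatedTree-isolate-leaf {k} tree p-branch = record
    { degreeSum≡ = +-cancelˡ-≡ 2 _ _ (begin
        2 + degreeSum (isolate G x)    ≡⟨ degreeSum-isolate-leaf G x leaf ⟨
        degreeSum G                    ≡⟨ degreeSum≡ ⟩
        suc k + suc k                  ≡⟨ cong suc (+-suc k k) ⟩
        2 + (k + k)                    ∎)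
    ; connected  = connected-isolate-leaf connected
    ; count≡     = suc-injective (trans (≡.sym (count-nonIsolated-isolate-leaf p-branch)) count≡)
    }
    where open NonIsolatedTree tree

nonIsolatedTree⇒bipartite×c4Free : ∀ {n} k {G : Graph n} → NonIsolatedTree k G → Bipartite G × C4Free G
nonIsolatedTree⇒bipartite×c4Free zero {G} tree =
  contradiction (subst₂ _≤_ count≡ degreeSum≡ (count-nonIsolated-≤ G)) λ ()
  where open NonIsolatedTree tree
nonIsolatedTree⇒bipartite×c4Free (suc k) {G} tree = lift reduced
  where
  open NonIsolatedTree tree
  fewer-edges : degreeSum G < count (isNonIsolated G) + count (isNonIsolated G)
  fewer-edges = subst₂ _<_ (≡.sym degreeSum≡) (cong₂ _+_ (≡.sym count≡) (≡.sym count≡))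
                           (+-mono-< (n<1+n (suc k)) (n<1+n (suc k)))
  x = proj₁ (leaf-exists G fewer-edges)
  leaf = proj₂ (leaf-exists G fewer-edges)
  p = proj₁ (neighbour G (≤-reflexive (≡.sym leaf)))
  xp = proj₂ (neighbour G (≤-reflexive (≡.sym leaf)))
  lift : Bipartite (isolate G x) × C4Free (isolate G x) → Bipartite G × C4Free G
  lift (bipartite , c4free) = bipartite-isolate-leaf G leaf xp bipartite , c4Free-isolate-leaf G leaf xp c4free
  reduced : Bipartite (isolate G x) × C4Free (isolate G x)
  reduced with degree G p ℕ.≟ 1
  ... | yes p-leaf = edgeless⇒bipartite×c4Free (isolate G x)
      (λ {u} {v} → isolate-leaf-pair-edgeless G leaf xp connected p-leaf {u} {v})
  ... | no p-branch = nonIsolatedTree⇒bipartite×c4Free k (nonIsolatedTree-isolate-leaf G leaf xp tree p-branch′)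
    where
    p-branch′ : 2 ≤ degree G p
    p-branch′ = ≤∧≢⇒< (degree-pos G (Adj-sym G xp)) (≢-sym p-branch)

-- The locating-dominating sets

trade-off : ∀ a b c d {k m} → a + b + d + (k + k) ≡ m + c → c ≤ k → a + b + c + d ≤ m
trade-off a b c d identity c≤k = +-cancelʳ-≤ c _ _
  (subst₂ _≤_ (≡.sym (rearrange a b c d)) identity (+-monoʳ-≤ (a + b + d) (+-mono-≤ c≤k c≤k)))
  where
  rearrange : ∀ a b c d → a + b + c + d + c ≡ a + b + d + (c + c)
  rearrange = solve-∀

smaller-half : ∀ a b c d {m} → a + b + c + d ≤ m → 2 * a + c + d ≤ m ⊎ 2 * b + c + d ≤ m
smaller-half a b c d bound = Sum.map (λ a≤b → ≤-trans (extend (double-≤ a≤b)) bound)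
  (λ b≤a → ≤-trans (extend (subst (2 * b ≤_) (+-comm b a) (double-≤ b≤a))) bound) (≤-total a b)
  where
  double-≤ : ∀ {x y} → x ≤ y → 2 * x ≤ x + y
  double-≤ {x} {y} x≤y = +-monoʳ-≤ x (subst (_≤ y) (≡.sym (+-identityʳ x)) x≤y)
  extend : ∀ {x} → x ≤ a + b → x + c + d ≤ a + b + c + d
  extend = +-monoˡ-≤ d ∘ +-monoˡ-≤ c

membership : (support leaf kept link colour : Bool) → Bool
membership true  _     _    _    _      = true
membership false true  kept _    _      = not kept
membership false false _    link colour = not link ∧ colour

membership-false : ∀ s l k sl c → membership s l k sl c ≡ false →
  s ≡ false × (l ≡ true × k ≡ true ⊎ l ≡ false × (sl ≡ true ⊎ sl ≡ false × c ≡ false))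
membership-false false true  true  _     _     _ = refl , inj₁ (refl , refl)
membership-false false false _     true  _     _ = refl , inj₂ (refl , inj₁ refl)
membership-false false false _     false false _ = refl , inj₂ (refl , inj₂ (refl , refl))

membership-identity : ∀ s l k sl c → (l ≡ true → s ≡ false) → (sl ≡ true → l ≡ false × s ≡ false) → (k ≡ true → l ≡ true) →
  ind (membership s l k sl c) + ind (membership s l k sl (not c)) + ind sl + (ind k + ind k) ≡ 1 + ind l + ind s
membership-identity true  true  _     _     _     l⇒¬s _    _   = contradiction (l⇒¬s refl) λ ()
membership-identity true  false _     true  _     _    sl⇒¬ _   = contradiction (proj₂ (sl⇒¬ refl)) λ ()
membership-identity true  false true  false _     _    _    k⇒l = contradiction (k⇒l refl) λ ()
membership-identity true  false false false _     _    _    _   = refl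
membership-identity false true  _     true  _     _    sl⇒¬ _   = contradiction (proj₁ (sl⇒¬ refl)) λ ()
membership-identity false true  true  false _     _    _    _   = refl
membership-identity false true  false false _     _    _    _   = refl
membership-identity false false true  _     _     _    _    k⇒l = contradiction (k⇒l refl) λ ()
membership-identity false false false true  _     _    _    _   = refl
membership-identity false false false false true  _    _    _   = refl
membership-identity false false false false false _    _    _   = refl

module LocatingSet {n : ℕ} (G : Graph n) (has-neighbour : ∀ u → ∃ (Adj G u))
  (leaf-not-support : ∀ {u} → isLeaf G u ≡ true → isSupport G u ≡ false) (c4free : C4Free G) where

  support-of : Fin n → Fin n
  support-of u = proj₁ (has-neighbour u)

  leaf-of : Fin n → Fin n
  leaf-of v with any? (λ w → adj G v w ∧ isLeaf G w Bool.≟ true)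
  ... | yes (w , _) = w
  ... | no _        = v

  leaf-of-spec : ∀ {v} → isSupport G v ≡ true → Adj G v (leaf-of v) × isLeaf G (leaf-of v) ≡ true
  leaf-of-spec {v} s with any? (λ w → adj G v w ∧ isLeaf G w Bool.≟ true)
  ... | yes (_ , q) = ∧-conicalˡ _ _ q , ∧-conicalʳ _ _ q
  ... | no ∄        = contradiction (Product.map₂ (λ (e , l) → cong₂ _∧_ e l) (support-elim G s)) ∄

  kept : Fin n → Bool
  kept u = isLeaf G u ∧ does (leaf-of (support-of u) ≟ u)

  locatingSet : (Fin n → Bool) → Fin n → Bool
  locatingSet colour u = membership (isSupport G u) (isLeaf G u) (kept u) (isSupportLink G u) (colour u)

  support-of-leaf : ∀ {u v} → isLeaf G u ≡ true → Adj G u v → support-of u ≡ v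
  support-of-leaf l e = degree1-unique G (leaf⇒degree1 G l) e (proj₂ (has-neighbour _))

  kept-leaf-of : ∀ {v} → isSupport G v ≡ true → kept (leaf-of v) ≡ true
  kept-leaf-of {v} s =
    cong₂ _∧_ leaf (trans (cong (λ w → does (leaf-of w ≟ leaf-of v)) back) (dec-true (leaf-of v ≟ leaf-of v) refl))
    where
    leaf = proj₂ (leaf-of-spec s)
    back = support-of-leaf leaf (Adj-sym G (proj₁ (leaf-of-spec s)))

  leaf-of-injective : ∀ {v v′} → isSupport G v ≡ true → isSupport G v′ ≡ true → leaf-of v ≡ leaf-of v′ → v ≡ v′
  leaf-of-injective {v} {v′} s s′ same = degree1-unique G (leaf⇒degree1 G (proj₂ (leaf-of-spec s′)))
    (Adj-sym G (proj₁ (leaf-of-spec s′))) (subst (λ w → Adj G w v) same (Adj-sym G (proj₁ (leaf-of-spec s))))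

  kept-is-leaf-of : ∀ {u} → kept u ≡ true → leaf-of (support-of u) ≡ u
  kept-is-leaf-of {u} k with leaf-of (support-of u) ≟ u
  ... | yes eq = eq
  ... | no _   = contradiction (trans (≡.sym k) (∧-zeroʳ (isLeaf G u))) λ ()

  supports≤kept : count (isSupport G) ≤ count kept
  supports≤kept = count-injective leaf-of kept-leaf-of leaf-of-injective

  module _ (colour : Fin n → Bool) (proper : ∀ {u v} → Adj G u v → colour v ≡ not (colour u)) where

    S : Fin n → Bool
    S = locatingSet colour

    support-in-S : ∀ {w} → isSupport G w ≡ true → S w ≡ true
    support-in-S {w} s = cong (λ b → membership b (isLeaf G w) (kept w) (isSupportLink G w) (colour w)) s

    Dominated : Fin n → Set
    Dominated u = (∀ {w} → Adj G u w → S w ≡ true) × 2 ≤ degree G u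

    non-leaf-degree : ∀ {u} → isLeaf G u ≡ false → 2 ≤ degree G u
    non-leaf-degree {u} l = ≤∧≢⇒< (degree-pos G (proj₂ (has-neighbour u)))
                                   (λ d → contradiction (trans (≡.sym (degree1⇒leaf G (≡.sym d))) l) λ ())

    neighbour-in-S : ∀ {u w} → isSupport G u ≡ false → isLeaf G u ≡ false → isSupportLink G u ≡ false → colour u ≡ false →
                     Adj G u w → S w ≡ true
    neighbour-in-S {u} {w} su lu slu cu e
      with isSupport G w Bool.≟ true | isLeaf G w Bool.≟ true | isSupportLink G w Bool.≟ true
    ... | yes sw | _      | _       = support-in-S sw
    ... | no _   | yes lw | _       = contradiction (trans (≡.sym (support-intro G e lw)) su) λ ()
    ... | no _   | no _   | yes slw =
      contradiction (trans (≡.sym (proj₂ (proj₂ (supportLink-elim G slw)) (Adj-sym G e))) su) λ ()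
    ... | no sw  | no lw  | no slw  = begin
      membership (isSupport G w) (isLeaf G w) (kept w) (isSupportLink G w) (colour w)
        ≡⟨ cong₂ (λ s l → membership s l (kept w) (isSupportLink G w) (colour w)) (¬-not sw) (¬-not lw) ⟩
      not (isSupportLink G w) ∧ colour w                ≡⟨ cong₂ (λ b c → not b ∧ c) (¬-not slw) (proper e) ⟩
      not (colour u)                                    ≡⟨ cong not cu ⟩
      true                                              ∎

    outside-S : ∀ {u} → S u ≡ false → isLeaf G u ≡ true × kept u ≡ true ⊎ Dominated u
    outside-S {u} out with membership-false (isSupport G u) (isLeaf G u) (kept u) (isSupportLink G u) (colour u) out
    ... | _  , inj₁ kept-leaf                  = inj₁ kept-leaf
    ... | _  , inj₂ (lu , inj₁ link)           =
      inj₂ ((λ e → support-in-S (proj₂ (proj₂ (supportLink-elim G link)) e)) , non-leaf-degree lu)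
    ... | su , inj₂ (lu , inj₂ (slu , cu))     = inj₂ (neighbour-in-S su lu slu cu , non-leaf-degree lu)

    same-S-neighbours : ∀ {u v} → (∀ w → (S w ∧ adj G u w) ≡ (S w ∧ adj G v w)) → ∀ {w} → S w ≡ true → Adj G u w → Adj G v w
    same-S-neighbours same {w} sw e = ∧-conicalʳ (S w) _ (trans (≡.sym (same w)) (cong₂ _∧_ sw e))

    dominated-vs-leaf : ∀ {u v} → Dominated u → isLeaf G v ≡ true → (∀ {w} → S w ≡ true → Adj G u w → Adj G v w) → ⊥
    dominated-vs-leaf (in-S , two) lv transfer with two-neighbours G two
    ... | a , b , b≢a , ua , ub = b≢a (degree1-unique G (leaf⇒degree1 G lv) (transfer (in-S ua) ua) (transfer (in-S ub) ub))

    isLocatingDominating : IsLocatingDominating G S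
    isLocatingDominating = dominating , locating
      where
      dominating : ∀ u → S u ≡ false → ∃ λ w → S w ≡ true × Adj G u w
      dominating u out with outside-S out
      ... | inj₁ (lu , _) = support-of u , support-in-S (support-intro G (Adj-sym G (proj₂ (has-neighbour u))) lu)
                                         , proj₂ (has-neighbour u)
      ... | inj₂ (in-S , _) = proj₁ (has-neighbour u) , in-S (proj₂ (has-neighbour u)) , proj₂ (has-neighbour u)

      locating : ∀ u v → S u ≡ false → S v ≡ false → u ≢ v → ¬ (∀ w → (S w ∧ adj G u w) ≡ (S w ∧ adj G v w))
      locating u v out-u out-v u≢v same with outside-S out-u | outside-S out-v
      ... | inj₂ dom-u | inj₁ (lv , _) = dominated-vs-leaf dom-u lv (same-S-neighbours same)
      ... | inj₁ (lu , _) | inj₂ dom-v = dominated-vs-leaf dom-v lu (same-S-neighbours (λ w → ≡.sym (same w)))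
      ... | inj₂ (in-S , two) | inj₂ _ with two-neighbours G two
      ...   | a , b , b≢a , ua , ub =
        c4free (≢-sym u≢v) b≢a ua ub (same-S-neighbours same (in-S ua) ua) (same-S-neighbours same (in-S ub) ub)
      locating u v out-u out-v u≢v same | inj₁ (lu , ku) | inj₁ (lv , kv) = u≢v (begin
        u                          ≡⟨ kept-is-leaf-of ku ⟨
        leaf-of (support-of u)     ≡⟨ cong leaf-of (support-of-leaf lv v-adjacent) ⟨
        leaf-of (support-of v)     ≡⟨ kept-is-leaf-of kv ⟩
        v                          ∎)
        where
        u-adjacent = proj₂ (has-neighbour u)
        v-adjacent = same-S-neighbours same (support-in-S (support-intro G (Adj-sym G u-adjacent) lu)) u-adjacent

  count-identity : ∀ colour →
    count (locatingSet colour) + count (locatingSet (not ∘ colour)) + supportLinks G + (count kept + count kept)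
      ≡ n + leaves G + supports G
  count-identity colour = begin
    count S₁ + count S₂ + count sl + (count kept + count kept)
      ≡⟨ cong₂ _+_ (cong₂ _+_ (count-+ S₁ S₂) (count≡∑ sl)) (count-+ kept kept) ⟩
    ∑ (λ i → ind (S₁ i) + ind (S₂ i)) + ∑ (λ i → ind (sl i)) + ∑ (λ i → ind (kept i) + ind (kept i))
      ≡⟨ cong (_+ ∑ (λ i → ind (kept i) + ind (kept i))) (∑-distrib-+ (λ i → ind (S₁ i) + ind (S₂ i)) (λ i → ind (sl i))) ⟨
    ∑ (λ i → ind (S₁ i) + ind (S₂ i) + ind (sl i)) + ∑ (λ i → ind (kept i) + ind (kept i))
      ≡⟨ ∑-distrib-+ (λ i → ind (S₁ i) + ind (S₂ i) + ind (sl i)) (λ i → ind (kept i) + ind (kept i)) ⟨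
    ∑ (λ i → ind (S₁ i) + ind (S₂ i) + ind (sl i) + (ind (kept i) + ind (kept i)))
      ≡⟨ sum-cong-≗ (λ i → membership-identity (isSupport G i) (isLeaf G i) (kept i) (sl i) (colour i)
                             leaf-not-support (λ e → Product.map₂ proj₁ (supportLink-elim G e)) (∧-conicalˡ _ _)) ⟩
    ∑ (λ i → 1 + ind (isLeaf G i) + ind (isSupport G i))
      ≡⟨ ∑-distrib-+ (λ i → 1 + ind (isLeaf G i)) (λ i → ind (isSupport G i)) ⟩
    ∑ (λ i → 1 + ind (isLeaf G i)) + ∑ (λ i → ind (isSupport G i))
      ≡⟨ cong₂ _+_ (count-+ (λ _ → true) (isLeaf G)) (count≡∑ (isSupport G)) ⟨
    count {n} (λ _ → true) + leaves G + supports G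
      ≡⟨ cong (λ m → m + leaves G + supports G) count-true ⟩
    n + leaves G + supports G ∎
    where
    S₁ = locatingSet colour
    S₂ = locatingSet (not ∘ colour)
    sl = isSupportLink G

  size-bound : ∀ colour →
    count (locatingSet colour) + count (locatingSet (not ∘ colour)) + supports G + supportLinks G ≤ n + leaves G
  size-bound colour = trade-off (count (locatingSet colour)) (count (locatingSet (not ∘ colour))) (supports G) (supportLinks G)
                                (count-identity colour) supports≤kept

  bipartite⇒bound : Bipartite G →
    Σ (Fin n → Bool) λ S → IsLocatingDominating G S × (2 * count S + supports G + supportLinks G ≤ n + leaves G)
  bipartite⇒bound (colour , proper)
    with smaller-half (count (locatingSet colour)) (count (locatingSet (not ∘ colour))) (supports G) (supportLinks G)
                      (size-bound colour)
  ... | inj₁ bound = locatingSet colour , isLocatingDominating colour proper , bound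
  ... | inj₂ bound = locatingSet (not ∘ colour) , isLocatingDominating (not ∘ colour) (cong not ∘ proper) , bound

other : ∀ {m} → Fin (2 + m) → Fin (2 + m)
other zero    = suc zero
other (suc _) = zero

other-≢ : ∀ {m} (u : Fin (2 + m)) → other u ≢ u
other-≢ zero    ()
other-≢ (suc _) ()

avoid-two : ∀ {m} (u v : Fin (3 + m)) → ∃ λ z → z ≢ u × z ≢ v
avoid-two zero             zero             = suc zero , (λ ()) , (λ ())
avoid-two zero             (suc zero)       = suc (suc zero) , (λ ()) , (λ ())
avoid-two zero             (suc (suc _))    = suc zero , (λ ()) , (λ ())
avoid-two (suc zero)       zero             = suc (suc zero) , (λ ()) , (λ ())
avoid-two (suc (suc _))    zero             = suc zero , (λ ()) , (λ ())
avoid-two (suc _)          (suc _)          = zero , (λ ()) , (λ ())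

module _ {m : ℕ} (G : Graph (2 + m)) (connected : Connected G) where

  connected⇒has-neighbour : ∀ u → ∃ (Adj G u)
  connected⇒has-neighbour u = first-step G (connected u (other u)) (other-≢ u)

  tree⇒nonIsolatedTree : edgeCount G + 1 ≡ 2 + m → NonIsolatedTree (edgeCount G) G
  tree⇒nonIsolatedTree edges = record
    { degreeSum≡ = handshake G
    ; connected  = λ {u} {v} _ _ → connected u v
    ; count≡     = begin
        count (isNonIsolated G)   ≡⟨ count-cong (λ u → nonIsolated-intro G (proj₂ (connected⇒has-neighbour u))) ⟩
        count {2 + m} (λ _ → true) ≡⟨ count-true ⟩
        2 + m                     ≡⟨ trans (≡.sym edges) (+-comm (edgeCount G) 1) ⟩
        suc (edgeCount G)         ∎
    }

leaf-not-support : ∀ {m} (G : Graph (3 + m)) → Connected G → ∀ {u} → isLeaf G u ≡ true → isSupport G u ≡ false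
leaf-not-support G connected {u} lu = ¬-not λ su →
  let v , uv , lv = support-elim G su
      z , z≢u , z≢v = avoid-two u v
  in case leaf-pair-closed G (leaf⇒degree1 G lu) uv (leaf⇒degree1 G lv) (connected u z) (inj₁ refl) of λ where
       (inj₁ z≡u) → z≢u z≡u
       (inj₂ z≡v) → z≢v z≡v

-- On two vertices both are leaves and support vertices, so S_C would be too large; {0} works.
module _ (G : Graph 2) (connected : Connected G) where

  private
    S : Fin 2 → Bool
    S i = does (i ≟ zero)

    the-other : ∀ {a u : Fin 2} → a ≢ u → a ≡ other u
    the-other {zero}     {zero}     a≢u = contradiction refl a≢u
    the-other {zero}     {suc zero} _   = refl
    the-other {suc zero} {zero}     _   = refl
    the-other {suc zero} {suc zero} a≢u = contradiction refl a≢u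

    all-leaves : ∀ u → isLeaf G u ≡ true
    all-leaves u =
      degree1⇒leaf G (≤-antisym (≮⇒≥ at-most-one) (degree-pos G (proj₂ (connected⇒has-neighbour G connected u))))
      where
      at-most-one : ¬ 1 < degree G u
      at-most-one two with two-neighbours G two
      ... | a , b , b≢a , ua , ub = b≢a (trans (the-other (Adj-irrefl G ub)) (≡.sym (the-other (Adj-irrefl G ua))))

    leaf-bound : ∀ s l r → l ≡ true → ind s + ind (not l ∧ r) ≤ ind l
    leaf-bound true  true _ _ = s≤s z≤n
    leaf-bound false true _ _ = z≤n

    supports+links≤leaves : supports G + supportLinks G ≤ leaves G
    supports+links≤leaves = subst₂ _≤_ (≡.sym (count-+ (isSupport G) (isSupportLink G))) (≡.sym (count≡∑ (isLeaf G)))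
      (∑-mono-≤ (λ i → leaf-bound (isSupport G i) (isLeaf G i)
                           (not (isSupport G i) ∧ allᵇ (λ v → not (adj G i v) ∨ isSupport G v)) (all-leaves i)))

    isLocatingDominating : IsLocatingDominating G S
    isLocatingDominating = dominating , locating
      where
      dominating : ∀ u → S u ≡ false → ∃ λ w → S w ≡ true × Adj G u w
      dominating (suc zero) _ with connected⇒has-neighbour G connected (suc zero)
      ... | w , e = zero , refl , subst (Adj G (suc zero)) (the-other (Adj-irrefl G e)) e
      locating : ∀ u v → S u ≡ false → S v ≡ false → u ≢ v → ¬ (∀ w → (S w ∧ adj G u w) ≡ (S w ∧ adj G v w))
      locating (suc zero) (suc zero) _ _ u≢v _ = u≢v refl

  single-edge-bound :
    Σ (Fin 2 → Bool) λ S → IsLocatingDominating G S × (2 * count S + supports G + supportLinks G ≤ 2 + leaves G)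
  single-edge-bound = S , isLocatingDominating ,
    subst (_≤ 2 + leaves G) (≡.sym (trans (cong (λ c → 2 * c + supports G + supportLinks G) (count-singleton {2} zero))
                                          (+-assoc 2 (supports G) (supportLinks G))))
          (+-monoʳ-≤ 2 supports+links≤leaves)

theorem17 : (n : ℕ) → 2 ≤ n → (T : Graph n) → IsTree T →
    Σ (Fin n → Bool) (λ S → IsLocatingDominating T S × (2 * count S + supports T + supportLinks T ≤ n + leaves T))
theorem17 (suc zero) (s≤s ()) _ _
theorem17 (suc (suc zero)) _ T (connected , _) = single-edge-bound T connected
theorem17 (suc (suc (suc m))) _ T (connected , edges)
  with nonIsolatedTree⇒bipartite×c4Free (edgeCount T) (tree⇒nonIsolatedTree T connected edges)
... | bipartite , c4free =
  LocatingSet.bipartite⇒bound T (connected⇒has-neighbour T connected) (leaf-not-support T connected) c4free bipartite
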